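{- Let $q$ be a prime power and let $t\ge2$ be a divisor of $q+1$; let $d=(q^2-1)/t$ and let $w_0,\dots,w_{t-1}$ be as in the context. Then $w_1=w_2=\dots=w_{t-1}=\frac{q+1}{t}$ and $w_0=\frac{q+1}{t}-1$; in particular the $w_u$ take exactly $2$ distinct values.
   Context: Identify the affine plane $AG(2,q)$ with $\mathbb{F}_{q^2}$, and let $\alpha$ be a primitive element of $\mathbb{F}_{q^2}$. Let $\mathcal{P}=\mathbb{F}_{q^2}^*$ (the affine points other than the origin $0$) and $P_i=\alpha^i$, $i=0,\dots,q^2-2$. Let $\mathcal{L}$ be the set of affine lines not through $0$. The map $\sigma:P_i\mapsto P_{i+1\bmod(q^2-1)}$ (multiplication by $\alpha$) is a collineation acting regularly on $\mathcal{P}$ and on $\mathcal{L}$. For $u=0,\dots,t-1$ let $O_u=\{P_i:i\equiv u\pmod t\}$. Let $\ell_0\in\mathcal{L}$ be a line parallel to the line through $0$ and $P_0$ (equivalently, $\ell_0$ is disjoint from the set $\{\lambda P_0:\lambda\in\mathbb{F}_q^*\}$), and put $w_u=|\ell_0\cap O_u|$. -}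

module Defs where

open import Level using (0ℓ)
open import Data.Nat using (ℕ; NonZero)
open import Data.Nat.DivMod using (_%_)
open import Data.Nat.Primality using (Prime)
open import Data.Fin using (Fin)
open import Data.List using (List; length; filter; upTo)
open import Data.Product using (Σ; ∃; ∃-syntax; _×_; _,_)
open import Relation.Nullary using (¬_; Dec; yes; no; _×-dec_)
open import Relation.Binary using (Decidable)
open import Relation.Binary.PropositionalEquality using (_≡_) renaming (setoid to ≡-setoid)
open import Algebra.Bundles using (CommutativeRing; Semiring)
open import Function.Bundles using (Bijection)
import Algebra.Definitions.RawSemiring as RS
import Data.Nat as ℕ

IsPrimePower : ℕ → Set
IsPrimePower q = ∃[ p ] ∃[ n ] (Prime p × 1 ℕ.≤ n × q ≡ p ℕ.^ n)

module _ (F : CommutativeRing 0ℓ 0ℓ) where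
  open CommutativeRing F
  open RS (Semiring.rawSemiring semiring) using () renaming (_^_ to _^ᶠ_)

  IsField : Set
  IsField = ¬ (1# ≈ 0#) × (∀ x → ¬ (x ≈ 0#) → ∃[ y ] (x * y ≈ 1#))

  HasCard : ℕ → Set
  HasCard m = Bijection (≡-setoid (Fin m)) setoid

  -- α is a primitive element of F (whose multiplicative group has order N = |F| - 1):
  -- α ≠ 0 and every nonzero element is a power α^i with 0 ≤ i < N
  IsPrimitive : ℕ → Carrier → Set
  IsPrimitive N α = ¬ (α ≈ 0#) × (∀ x → ¬ (x ≈ 0#) → ∃[ i ] (i ℕ.< N × x ≈ α ^ᶠ i))

  InFq : ℕ → Carrier → Set
  InFq q x = x ^ᶠ q ≈ x

  -- membership in the affine line ℓ₀ = a + F_q (the line through a parallel to the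
  -- line through 0 and P₀ = 1 = α^0)
  OnLine : ℕ → Carrier → Carrier → Set
  OnLine q a x = InFq q (x - a)

  module _ (_≈?_ : Decidable _≈_) where
    -- w u = |ℓ₀ ∩ O_u| = #{ i : 0 ≤ i < q²-1, i ≡ u (mod t), α^i ∈ ℓ₀ }
    w : (q t : ℕ) .{{_ : NonZero t}} → Carrier → Carrier → ℕ → ℕ
    w q t α a u =
      length (filter (λ i → ((i % t) ℕ.≟ u) ×-dec (((α ^ᶠ i - a) ^ᶠ q) ≈? (α ^ᶠ i - a)))
                     (upTo (q ℕ.* q ℕ.∸ 1)))

module Submission where

-- The lines of AG(2,q) = F_{q²} through 0 are the cosets α^j F_q, and α^i lies on α^j F_q iff
-- i ≡ j (mod q+1), because α^(q+1) generates F_q^*. The line ℓ₀ = a + F_q (a ∉ F_q) is parallel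
-- to F_q = α^0 F_q and meets every other line through 0 exactly once: at most once since two of
-- its points x, xk with k ∈ F_q \ {1} would put a into F_q, and at least once since
-- F = β F_q + F_q for β ∉ F_q by counting. So i ↦ i mod (q+1) is a bijection from
-- {i < q² - 1 : α^i ∈ ℓ₀} onto {1, …, q}, and as t ∣ q + 1 it preserves residues mod t.
-- Hence w_u counts the j ∈ {1, …, q} with j ≡ u (mod t): (q+1)/t of them, less one for
-- u = 0 because j = 0 is excluded. Here F_q = {x : x^q = x}, a subfield because
-- |F| = p^(2n) forces characteristic p, which makes x ↦ x^q additive.

open import Level using (0ℓ)

-- Counting over initial segments of ℕ

module Counting where

  open import Data.Nat using (ℕ; zero; suc; _+_; _*_; _∸_; _<_; _≤_; _<?_; _≟_; NonZero; >-nonZero⁻¹; z≤n; s≤s)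
  open import Data.Nat.Properties
  open import Data.Nat.DivMod using (_%_; m<n⇒m%n≡m; [m+n]%n≡m%n)
  open import Data.List using (length; filter; upTo; [_]; _++_)
  open import Data.List.Properties using (upTo-∷ʳ; length-++; filter-++; filter-accept; filter-reject)
  open import Data.Product using (∃-syntax; _×_; _,_; proj₁; proj₂)
  open import Function using (_∘_)
  open import Relation.Nullary using (¬_; yes; no; contradiction)
  open import Relation.Unary using (Pred; Decidable; _∩_)
  open import Relation.Unary.Properties using (_∩?_; ∁?)
  open import Relation.Binary.PropositionalEquality using (_≡_; refl; sym; trans; cong; cong₂; subst; module ≡-Reasoning)
  open ≡-Reasoning

  private variable
    A P Q S : Pred ℕ 0ℓ
    n : ℕ

  count : Decidable P → ℕ → ℕ
  count P? n = length (filter P? (upTo n))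

  count-suc : (P? : Decidable P) (n : ℕ) → count P? (suc n) ≡ count P? n + length (filter P? [ n ])
  count-suc P? n = begin
    length (filter P? (upTo (suc n)))              ≡⟨ cong (length ∘ filter P?) (upTo-∷ʳ n) ⟨
    length (filter P? (upTo n ++ [ n ]))           ≡⟨ cong length (filter-++ P? (upTo n) [ n ]) ⟩
    length (filter P? (upTo n) ++ filter P? [ n ]) ≡⟨ length-++ (filter P? (upTo n)) ⟩
    count P? n + length (filter P? [ n ])          ∎

  count-accept : (P? : Decidable P) → P n → count P? (suc n) ≡ suc (count P? n)
  count-accept {n = n} P? pn = begin
    count P? (suc n)                       ≡⟨ count-suc P? n ⟩
    count P? n + length (filter P? [ n ])  ≡⟨ cong (λ xs → count P? n + length xs) (filter-accept P? pn) ⟩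
    count P? n + 1                         ≡⟨ +-comm (count P? n) 1 ⟩
    suc (count P? n)                       ∎

  count-reject : (P? : Decidable P) → ¬ P n → count P? (suc n) ≡ count P? n
  count-reject {n = n} P? ¬pn = begin
    count P? (suc n)                       ≡⟨ count-suc P? n ⟩
    count P? n + length (filter P? [ n ])  ≡⟨ cong (λ xs → count P? n + length xs) (filter-reject P? ¬pn) ⟩
    count P? n + 0                         ≡⟨ +-identityʳ (count P? n) ⟩
    count P? n                             ∎

  count-cong : (P? : Decidable P) (Q? : Decidable Q) (n : ℕ) →
               (∀ {i} → i < n → P i → Q i) → (∀ {i} → i < n → Q i → P i) →
               count P? n ≡ count Q? n
  count-cong P? Q? zero P⇒Q Q⇒P = refl
  count-cong P? Q? (suc n) P⇒Q Q⇒P with P? n | Q? n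
  ... | yes pn | yes qn = begin
    count P? (suc n) ≡⟨ count-accept P? pn ⟩
    suc (count P? n) ≡⟨ cong suc (count-cong P? Q? n (P⇒Q ∘ m<n⇒m<1+n) (Q⇒P ∘ m<n⇒m<1+n)) ⟩
    suc (count Q? n) ≡⟨ count-accept Q? qn ⟨
    count Q? (suc n) ∎
  ... | no ¬pn | no ¬qn = begin
    count P? (suc n) ≡⟨ count-reject P? ¬pn ⟩
    count P? n       ≡⟨ count-cong P? Q? n (P⇒Q ∘ m<n⇒m<1+n) (Q⇒P ∘ m<n⇒m<1+n) ⟩
    count Q? n       ≡⟨ count-reject Q? ¬qn ⟨
    count Q? (suc n) ∎
  ... | yes pn | no ¬qn = contradiction (P⇒Q (n<1+n n) pn) ¬qn
  ... | no ¬pn | yes qn = contradiction (Q⇒P (n<1+n n) qn) ¬pn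

  count-none : (P? : Decidable P) (n : ℕ) → (∀ {i} → i < n → ¬ P i) → count P? n ≡ 0
  count-none P? zero ¬P = refl
  count-none P? (suc n) ¬P = trans (count-reject P? (¬P (n<1+n n))) (count-none P? n (¬P ∘ m<n⇒m<1+n))

  count-unique : (P? : Decidable P) (n : ℕ) {k : ℕ} → k < n → P k → (∀ {i} → i < n → P i → i ≡ k) → count P? n ≡ 1
  count-unique P? (suc n) {k} k<1+n pk unique with P? n
  ... | yes pn with refl ← unique (n<1+n n) pn = begin
    count P? (suc k) ≡⟨ count-accept P? pk ⟩
    suc (count P? k) ≡⟨ cong suc (count-none P? k (λ i<k pi → <-irrefl (unique (m<n⇒m<1+n i<k) pi) i<k)) ⟩
    1                ∎
  ... | no ¬pn = trans (count-reject P? ¬pn) (count-unique P? n k<n pk (unique ∘ m<n⇒m<1+n))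
    where
    k<n : k < n
    k<n = ≤∧≢⇒< (≤-pred k<1+n) λ { refl → ¬pn pk }

  count-partition : (P? : Decidable P) (S? : Decidable S) (n : ℕ) →
                    count P? n ≡ count (P? ∩? S?) n + count (P? ∩? ∁? S?) n
  count-partition P? S? zero = refl
  count-partition P? S? (suc n) with P? n | S? n
  ... | no ¬pn | _ = begin
    count P? (suc n)                                          ≡⟨ count-reject P? ¬pn ⟩
    count P? n                                                ≡⟨ count-partition P? S? n ⟩
    count (P? ∩? S?) n + count (P? ∩? ∁? S?) n                ≡⟨ cong₂ _+_ (count-reject (P? ∩? S?) (¬pn ∘ proj₁))
                                                                           (count-reject (P? ∩? ∁? S?) (¬pn ∘ proj₁)) ⟨
    count (P? ∩? S?) (suc n) + count (P? ∩? ∁? S?) (suc n)    ∎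
  ... | yes pn | yes sn = begin
    count P? (suc n)                                          ≡⟨ count-accept P? pn ⟩
    suc (count P? n)                                          ≡⟨ cong suc (count-partition P? S? n) ⟩
    suc (count (P? ∩? S?) n) + count (P? ∩? ∁? S?) n          ≡⟨ cong₂ _+_ (count-accept (P? ∩? S?) (pn , sn))
                                                                           (count-reject (P? ∩? ∁? S?) (λ (_ , ¬sn) → ¬sn sn)) ⟨
    count (P? ∩? S?) (suc n) + count (P? ∩? ∁? S?) (suc n)    ∎
  ... | yes pn | no ¬sn = begin
    count P? (suc n)                                          ≡⟨ count-accept P? pn ⟩
    suc (count P? n)                                          ≡⟨ cong suc (count-partition P? S? n) ⟩
    suc (count (P? ∩? S?) n + count (P? ∩? ∁? S?) n)          ≡⟨ +-suc (count (P? ∩? S?) n) _ ⟨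
    count (P? ∩? S?) n + suc (count (P? ∩? ∁? S?) n)          ≡⟨ cong₂ _+_ (count-reject (P? ∩? S?) (¬sn ∘ proj₂))
                                                                           (count-accept (P? ∩? ∁? S?) (pn , ¬sn)) ⟨
    count (P? ∩? S?) (suc n) + count (P? ∩? ∁? S?) (suc n)    ∎

  count-+ : (P? : Decidable P) (m n : ℕ) → count P? (m + n) ≡ count P? m + count (P? ∘ (m +_)) n
  count-+ P? m zero = begin
    count P? (m + 0)  ≡⟨ cong (count P?) (+-identityʳ m) ⟩
    count P? m        ≡⟨ +-identityʳ (count P? m) ⟨
    count P? m + 0    ∎
  count-+ P? m (suc n) with P? (m + n)
  ... | yes p rewrite +-suc m n = begin
    count P? (suc (m + n))                       ≡⟨ count-accept P? p ⟩
    suc (count P? (m + n))                       ≡⟨ cong suc (count-+ P? m n) ⟩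
    suc (count P? m + count (P? ∘ (m +_)) n)      ≡⟨ +-suc (count P? m) _ ⟨
    count P? m + suc (count (P? ∘ (m +_)) n)      ≡⟨ cong (count P? m +_) (count-accept (P? ∘ (m +_)) p) ⟨
    count P? m + count (P? ∘ (m +_)) (suc n)      ∎
  ... | no ¬p rewrite +-suc m n = begin
    count P? (suc (m + n))                       ≡⟨ count-reject P? ¬p ⟩
    count P? (m + n)                             ≡⟨ count-+ P? m n ⟩
    count P? m + count (P? ∘ (m +_)) n            ≡⟨ cong (count P? m +_) (count-reject (P? ∘ (m +_)) ¬p) ⟨
    count P? m + count (P? ∘ (m +_)) (suc n)      ∎

  count-residue : (t u s : ℕ) .{{_ : NonZero t}} → u < t → count (λ j → j % t ≟ u) (s * t) ≡ s
  count-residue t u zero    u<t = refl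
  count-residue t u (suc s) u<t = begin
    count (λ j → j % t ≟ u) (t + s * t)                                    ≡⟨ count-+ (λ j → j % t ≟ u) t (s * t) ⟩
    count (λ j → j % t ≟ u) t + count (λ j → (t + j) % t ≟ u) (s * t)      ≡⟨ cong₂ _+_ first-period shifted-periods ⟩
    suc s                                                                  ∎
    where
    first-period : count (λ j → j % t ≟ u) t ≡ 1
    first-period = count-unique (λ j → j % t ≟ u) t u<t (m<n⇒m%n≡m u<t) λ j<t j%t≡u → trans (sym (m<n⇒m%n≡m j<t)) j%t≡u
    [t+j]%t≡j%t : ∀ j → (t + j) % t ≡ j % t
    [t+j]%t≡j%t j = trans (cong (_% t) (+-comm t j)) ([m+n]%n≡m%n j t)
    shifted-periods : count (λ j → (t + j) % t ≟ u) (s * t) ≡ s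
    shifted-periods = trans (count-cong (λ j → (t + j) % t ≟ u) (λ j → j % t ≟ u) (s * t)
                                        (λ {j} _ → trans (sym ([t+j]%t≡j%t j))) (λ {j} _ → trans ([t+j]%t≡j%t j)))
                            (count-residue t u s u<t)

  module _ {P Q : Pred ℕ 0ℓ} (P? : Decidable P) (Q? : Decidable Q) {N m : ℕ} (g : ℕ → ℕ)
           (g-into : ∀ {i} → i < N → P i → g i < m × Q (g i))
           (g-injective : ∀ {i i′} → i < N → i′ < N → P i → P i′ → g i ≡ g i′ → i ≡ i′)
           (g-onto : ∀ {j} → j < m → Q j → ∃[ i ] i < N × P i × g i ≡ j) where

    private
      Preimage? : Decidable A → Decidable ((A ∘ g) ∩ P)
      Preimage? A? = (A? ∘ g) ∩? P?

      below? : (k : ℕ) → Decidable (λ i → g i < k)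
      below? k i = g i <? k

      at? : (k : ℕ) → Decidable (λ i → g i ≡ k)
      at? k i = g i ≟ k

      count-fibre : {A : Pred ℕ 0ℓ} (A? : Decidable A) {k : ℕ} → k < m →
                    count (Preimage? A? ∩? at? k) N ≡ length (filter (A? ∩? Q?) [ k ])
      count-fibre {A} A? {k} k<m with A? k | Q? k
      ... | yes ak | yes qk with i , i<N , pi , gi≡k ← g-onto k<m qk =
        count-unique (Preimage? A? ∩? at? k) N i<N ((subst A (sym gi≡k) ak , pi) , gi≡k)
                     λ i′<N ((_ , pi′) , gi′≡k) → g-injective i′<N i<N pi′ pi (trans gi′≡k (sym gi≡k))
      ... | no ¬ak | _      = count-none (Preimage? A? ∩? at? k) N λ _ ((agi , _) , gi≡k) → ¬ak (subst A gi≡k agi)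
      ... | yes _  | no ¬qk = count-none (Preimage? A? ∩? at? k) N
                                λ i<N ((_ , pi) , gi≡k) → ¬qk (subst Q gi≡k (proj₂ (g-into i<N pi)))

      count-preimage-below : {A : Pred ℕ 0ℓ} (A? : Decidable A) (k : ℕ) → k ≤ m →
                             count (Preimage? A? ∩? below? k) N ≡ count (A? ∩? Q?) k
      count-preimage-below A? zero    _   = count-none (Preimage? A? ∩? below? 0) N λ { _ (_ , ()) }
      count-preimage-below {A} A? (suc k) k<m = begin
        count B? N                                                  ≡⟨ count-partition B? (below? k) N ⟩
        count (B? ∩? below? k) N + count (B? ∩? ∁? (below? k)) N    ≡⟨ cong₂ _+_ below-k at-k ⟩
        count (Preimage? A? ∩? below? k) N + count (Preimage? A? ∩? at? k) N
                                                                    ≡⟨ cong₂ _+_ (count-preimage-below A? k (<⇒≤ k<m))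
                                                                                 (count-fibre A? k<m) ⟩
        count (A? ∩? Q?) k + length (filter (A? ∩? Q?) [ k ])       ≡⟨ count-suc (A? ∩? Q?) k ⟨
        count (A? ∩? Q?) (suc k)                                    ∎
        where
        B? : Decidable (((A ∘ g) ∩ P) ∩ (λ i → g i < suc k))
        B? = Preimage? A? ∩? below? (suc k)
        below-k : count (B? ∩? below? k) N ≡ count (Preimage? A? ∩? below? k) N
        below-k = count-cong (B? ∩? below? k) (Preimage? A? ∩? below? k) N
                             (λ _ ((ap , _) , b) → ap , b) (λ _ (ap , b) → (ap , m<n⇒m<1+n b) , b)
        at-k : count (B? ∩? ∁? (below? k)) N ≡ count (Preimage? A? ∩? at? k) N
        at-k = count-cong (B? ∩? ∁? (below? k)) (Preimage? A? ∩? at? k) N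
                          (λ _ ((ap , b) , ¬b) → ap , ≤-antisym (≤-pred b) (≮⇒≥ ¬b))
                          (λ _ (ap , gi≡k) → (ap , ≤-reflexive (cong suc gi≡k)) , <-irrefl gi≡k)

    count-image : (A? : Decidable A) → count ((A? ∘ g) ∩? P?) N ≡ count (A? ∩? Q?) m
    count-image A? = trans (count-cong (Preimage? A?) (Preimage? A? ∩? below? m) N
                                       (λ i<N (a , p) → (a , p) , proj₁ (g-into i<N p)) (λ _ → proj₁))
                           (count-preimage-below A? m ≤-refl)

  count-residue-positive : (t u s : ℕ) .{{_ : NonZero t}} → 0 < u → u < t →
                           count ((λ j → j % t ≟ u) ∩? (0 <?_)) (s * t) ≡ s
  count-residue-positive t u s 0<u u<t = trans
    (count-cong ((λ j → j % t ≟ u) ∩? (0 <?_)) (λ j → j % t ≟ u) (s * t) (λ _ → proj₁) (λ _ j%t≡u → j%t≡u , 0<j j%t≡u))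
    (count-residue t u s u<t)
    where
    0<j : ∀ {j} → j % t ≡ u → 0 < j
    0<j {zero}  0%t≡u = contradiction (trans (sym 0%t≡u) (m<n⇒m%n≡m (>-nonZero⁻¹ t))) (>⇒≢ 0<u)
    0<j {suc j} _     = s≤s z≤n

  count-residue-zero : (t s : ℕ) .{{_ : NonZero t}} → count ((λ j → j % t ≟ 0) ∩? (0 <?_)) (s * t) ≡ s ∸ 1
  count-residue-zero t zero    = refl
  count-residue-zero t (suc s) = +-cancelʳ-≡ 1 _ s (begin
    count (R? ∩? positive?) st + 1                                ≡⟨ cong (count (R? ∩? positive?) st +_) zero-once ⟨
    count (R? ∩? positive?) st + count (R? ∩? ∁? positive?) st    ≡⟨ count-partition R? positive? st ⟨
    count R? st                                                   ≡⟨ count-residue t 0 (suc s) (>-nonZero⁻¹ t) ⟩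
    suc s                                                         ≡⟨ +-comm 1 s ⟩
    s + 1                                                         ∎)
    where
    st : ℕ
    st = suc s * t
    R? : Decidable (λ j → j % t ≡ 0)
    R? j = j % t ≟ 0
    positive? : Decidable (0 <_)
    positive? = 0 <?_
    zero-once : count (R? ∩? ∁? positive?) st ≡ 1
    zero-once = count-unique (R? ∩? ∁? positive?) st (<-≤-trans (>-nonZero⁻¹ t) (m≤m+n t (s * t)))
                             (m<n⇒m%n≡m (>-nonZero⁻¹ t) , λ ()) (λ _ (_ , j≯0) → n≤0⇒n≡0 (≮⇒≥ j≯0))

open import Defs
open import Data.Nat as ℕ using (ℕ; zero; suc; _∸_; z≤n; s≤s; NonZero; _≟_; _<?_; nonTrivial⇒n>1)
open import Data.Nat.Properties as ℕ using ()
open import Data.Nat.Combinatorics using (_C_; nCn≡1; nC1≡n; k>n⇒nCk≡0; nCk+nC[k+1]≡[n+1]C[k+1])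
open import Data.Nat.DivMod using (_%_; _/_; m≡m%n+[m/n]*n; m%n<n; %-remove-+ʳ; m∣n⇒o%n%m≡o%m; m<n⇒m%n≡m; m/n*n≡m)
open import Data.Nat.Divisibility using (_∣_; divides; ∣⇒≤; *-cancelʳ-∣; *-pres-∣; ∣-refl; m∣m*n; m%n≡0⇒n∣m)
open import Data.Nat.Primality using (Prime; euclidsLemma; prime⇒nonZero; prime⇒nonTrivial)
open import Data.Fin as Fin using (Fin; zero; suc; toℕ; inject₁; fromℕ; fromℕ<)
open import Data.Fin.Properties
  using (any?; injective⇒≤; punchOut-injective; *↔×; toℕ-inject₁; toℕ-fromℕ; toℕ<n; toℕ-injective; fromℕ<-injective; suc-injective)
open import Data.Product using (∃-syntax; _×_; _,_; proj₁; proj₂)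
open import Data.Sum using (inj₁; inj₂)
open import Data.Empty using (⊥)
open import Function using (_∘_)
open import Function.Bundles using (Bijection; Inverse)
open import Function.Properties.Bijection using (Bijection⇒Inverse)
open import Relation.Nullary using (¬_; Dec; yes; no; contradiction)
open import Relation.Binary using (Decidable)
open import Relation.Binary.PropositionalEquality as ≡ using (_≡_) renaming (setoid to ≡-setoid)
open import Relation.Unary.Properties using (_∩?_)
open import Algebra.Bundles using (CommutativeSemiring; CommutativeRing; AbelianGroup)
open Counting

-- Arithmetic and binomial coefficients

q*q∸1≡[1+q]*[q∸1] : ∀ q → q ℕ.* q ∸ 1 ≡ suc q ℕ.* (q ∸ 1)
q*q∸1≡[1+q]*[q∸1] zero    = ≡.refl
q*q∸1≡[1+q]*[q∸1] (suc r) = r+r*[1+r]≡[2+r]*r r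
  where
  open import Data.Nat.Tactic.RingSolver using (solve-∀)
  r+r*[1+r]≡[2+r]*r : ∀ r → r ℕ.+ r ℕ.* suc r ≡ suc (suc r) ℕ.* r
  r+r*[1+r]≡[2+r]*r = solve-∀

%≡%⇒∣∸ : ∀ d .{{_ : NonZero d}} {i j} → i % d ≡ j % d → d ∣ j ∸ i
%≡%⇒∣∸ d {i} {j} i≡j = divides (j / d ∸ i / d) (begin
  j ∸ i                                              ≡⟨ ≡.cong₂ _∸_ (m≡m%n+[m/n]*n j d) (m≡m%n+[m/n]*n i d) ⟩
  (j % d ℕ.+ j / d ℕ.* d) ∸ (i % d ℕ.+ i / d ℕ.* d)  ≡⟨ ≡.cong (λ r → (r ℕ.+ j / d ℕ.* d) ∸ (i % d ℕ.+ i / d ℕ.* d)) i≡j ⟨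
  (i % d ℕ.+ j / d ℕ.* d) ∸ (i % d ℕ.+ i / d ℕ.* d)  ≡⟨ ℕ.[m+n]∸[m+o]≡n∸o (i % d) _ _ ⟩
  j / d ℕ.* d ∸ i / d ℕ.* d                          ≡⟨ ℕ.*-distribʳ-∸ d (j / d) (i / d) ⟨
  (j / d ∸ i / d) ℕ.* d                              ∎)
  where open ≡.≡-Reasoning

[1+k]*[1+n]C[1+k]≡[1+n]*nCk : ∀ n k → suc k ℕ.* (suc n C suc k) ≡ suc n ℕ.* (n C k)
[1+k]*[1+n]C[1+k]≡[1+n]*nCk zero    zero    = ≡.refl
[1+k]*[1+n]C[1+k]≡[1+n]*nCk zero    (suc k) rewrite k>n⇒nCk≡0 {1} {suc (suc k)} (s≤s (s≤s z≤n))
                                               | k>n⇒nCk≡0 {0} {suc k} (s≤s z≤n) = ℕ.*-zeroʳ (suc (suc k))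
[1+k]*[1+n]C[1+k]≡[1+n]*nCk (suc n) zero    rewrite nC1≡n (suc (suc n)) = ℕ.*-comm 1 (suc (suc n))
[1+k]*[1+n]C[1+k]≡[1+n]*nCk (suc n) (suc k) = begin
  suc (suc k) ℕ.* (suc (suc n) C suc (suc k))         ≡⟨ ≡.cong (suc (suc k) ℕ.*_) (nCk+nC[k+1]≡[n+1]C[k+1] (suc n) (suc k)) ⟨
  suc (suc k) ℕ.* (A ℕ.+ B)                          ≡⟨ expand k A B ⟩
  A ℕ.+ suc k ℕ.* A ℕ.+ suc (suc k) ℕ.* B             ≡⟨ ≡.cong₂ (λ u v → A ℕ.+ u ℕ.+ v)
                                                          ([1+k]*[1+n]C[1+k]≡[1+n]*nCk n k) ([1+k]*[1+n]C[1+k]≡[1+n]*nCk n (suc k)) ⟩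
  A ℕ.+ suc n ℕ.* (n C k) ℕ.+ suc n ℕ.* (n C suc k)   ≡⟨ factor n A (n C k) (n C suc k) ⟩
  A ℕ.+ suc n ℕ.* (n C k ℕ.+ n C suc k)               ≡⟨ ≡.cong (λ u → A ℕ.+ suc n ℕ.* u) (nCk+nC[k+1]≡[n+1]C[k+1] n k) ⟩
  suc (suc n) ℕ.* A                                  ∎
  where
  open ≡.≡-Reasoning
  open import Data.Nat.Tactic.RingSolver using (solve-∀)
  A B : ℕ
  A = suc n C suc k
  B = suc n C suc (suc k)
  expand : ∀ k A B → suc (suc k) ℕ.* (A ℕ.+ B) ≡ A ℕ.+ suc k ℕ.* A ℕ.+ suc (suc k) ℕ.* B
  expand = solve-∀
  factor : ∀ n A X Y → A ℕ.+ suc n ℕ.* X ℕ.+ suc n ℕ.* Y ≡ A ℕ.+ suc n ℕ.* (X ℕ.+ Y)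
  factor = solve-∀

p∣pCk : ∀ {p k} → Prime p → 0 ℕ.< k → k ℕ.< p → p ∣ p C k
p∣pCk {suc n} {suc k} p-prime _ k<p
  with euclidsLemma (suc k) (suc n C suc k) p-prime
         (divides (n C k) (≡.trans ([1+k]*[1+n]C[1+k]≡[1+n]*nCk n k) (ℕ.*-comm (suc n) (n C k))))
... | inj₂ p∣pCk = p∣pCk
... | inj₁ p∣1+k = contradiction (ℕ.<-≤-trans k<p (∣⇒≤ p∣1+k)) (ℕ.<-irrefl ≡.refl)

-- Finite abelian groups and the Frobenius map

module _ (G : AbelianGroup 0ℓ 0ℓ) where

  open AbelianGroup G
  open import Algebra.Properties.AbelianGroup G using (//-rightDividesʳ)
  open import Relation.Binary.Reasoning.Setoid setoid

  x∙y≈z∙w⇒x-z≈w-y : ∀ {x y z w} → x ∙ y ≈ z ∙ w → x - z ≈ w - y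
  x∙y≈z∙w⇒x-z≈w-y {x} {y} {z} {w} eq = begin
    x - z                ≈⟨ ∙-congʳ (//-rightDividesʳ y x) ⟨
    ((x ∙ y) - y) - z    ≈⟨ ∙-congʳ (∙-congʳ eq) ⟩
    ((z ∙ w) - y) - z    ≈⟨ ∙-congʳ (assoc z w (y ⁻¹)) ⟩
    (z ∙ (w - y)) - z    ≈⟨ ∙-congʳ (comm z (w - y)) ⟩
    ((w - y) ∙ z) - z    ≈⟨ //-rightDividesʳ z (w - y) ⟩
    w - y                ∎

module FiniteAbelianGroup (G : AbelianGroup 0ℓ 0ℓ) {M : ℕ}
                          (enum : Bijection (≡-setoid (Fin M)) (AbelianGroup.setoid G)) where

  open AbelianGroup G
  open import Algebra.Properties.AbelianGroup G using (identityʳ-unique; //-rightDividesˡ; //-rightDividesʳ)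
  open import Algebra.Properties.Monoid.Mult monoid using () renaming (_×_ to _·_)
  open import Algebra.Properties.CommutativeMonoid.Sum commutativeMonoid
    using (sum; sum-permute; ∑-distrib-+; sum-replicate; sum-cong-≋)
  open import Data.Fin.Permutation using (Permutation; permutation)
  open Inverse (Bijection⇒Inverse enum) using (to; from; from-cong; strictlyInverseˡ; strictlyInverseʳ)
  open import Relation.Binary.Reasoning.Setoid setoid

  translation : Carrier → Permutation M M
  translation x = permutation (λ k → from (to k ∙ x)) (λ k → from (to k - x))
    (λ k → ≡.trans (from-cong (trans (∙-congʳ (strictlyInverseˡ _)) (//-rightDividesˡ x (to k)))) (strictlyInverseʳ k))
    (λ k → ≡.trans (from-cong (trans (∙-congʳ (strictlyInverseˡ _)) (//-rightDividesʳ x (to k)))) (strictlyInverseʳ k))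

  -- Translation by x permutes G, so Σ g = Σ (g ∙ x) = (Σ g) ∙ M · x.
  card·x≈ε : ∀ x → M · x ≈ ε
  card·x≈ε x = identityʳ-unique (sum to) (M · x) (begin
    sum to ∙ M · x                     ≈⟨ ∙-congˡ (sum-replicate M) ⟨
    sum to ∙ sum {M} (λ _ → x)         ≈⟨ ∑-distrib-+ to (λ _ → x) ⟨
    sum (λ k → to k ∙ x)               ≈⟨ sum-cong-≋ (λ k → strictlyInverseˡ (to k ∙ x)) ⟨
    sum (λ k → to (from (to k ∙ x)))   ≈⟨ sum-permute to (translation x) ⟨
    sum to                             ∎)

module Frobenius (R : CommutativeSemiring 0ℓ 0ℓ) where

  open CommutativeSemiring R hiding (zero)
  open import Algebra.Properties.Semiring.Mult semiring using (×-congˡ; ×-congʳ; ×-assocˡ; ×-assoc-*) renaming (_×_ to _·_)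
  open import Algebra.Properties.Semiring.Exp semiring using (_^_; ^-congʳ; ^-congˡ; ^-assocʳ)
  open import Algebra.Properties.Semiring.Sum semiring using (sum; sum-init-last; sum-cong-≋; sum-replicate-zero)
  open import Algebra.Properties.CommutativeSemiring.Binomial R using (theorem; binomialTerm)
  open import Relation.Binary.Reasoning.Setoid setoid

  n·0≈0 : ∀ n → n · 0# ≈ 0#
  n·0≈0 zero    = refl
  n·0≈0 (suc n) = trans (+-identityˡ (n · 0#)) (n·0≈0 n)

  m∣n⇒n·x≈0 : ∀ {m n} → m · 1# ≈ 0# → ∀ x → m ∣ n → n · x ≈ 0#
  m∣n⇒n·x≈0 {m} {n} m·1≈0 x (divides c n≡c*m) = begin
    n · x              ≈⟨ ×-congˡ n≡c*m ⟩
    (c ℕ.* m) · x      ≈⟨ ×-assocˡ x c m ⟨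
    c · (m · x)        ≈⟨ ×-congʳ c m·x≈0 ⟩
    c · 0#             ≈⟨ n·0≈0 c ⟩
    0#                 ∎
    where
    m·x≈0 : m · x ≈ 0#
    m·x≈0 = begin
      m · x            ≈⟨ ×-congʳ m (*-identityˡ x) ⟨
      m · (1# * x)     ≈⟨ ×-assoc-* m 1# x ⟨
      (m · 1#) * x     ≈⟨ *-congʳ m·1≈0 ⟩
      0# * x           ≈⟨ zeroˡ x ⟩
      0#               ∎

  frobenius-prime : ∀ {p} → Prime p → p · 1# ≈ 0# → ∀ x y → (x + y) ^ p ≈ x ^ p + y ^ p
  frobenius-prime {suc p′} p-prime p·1≈0 x y = begin
    (x + y) ^ p                                                      ≈⟨ theorem p x y ⟩
    t zero + sum (λ k → t (suc k))                                   ≈⟨ +-congˡ (sum-init-last (λ k → t (suc k))) ⟩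
    t zero + (sum (λ k → t (suc (inject₁ k))) + t (suc (fromℕ p′)))   ≈⟨ +-congˡ (+-cong middle≈0 (last≈xᵖ _ top≡p)) ⟩
    (1# * y ^ p + 0#) + (0# + x ^ p)                                 ≈⟨ +-cong (trans (+-identityʳ _) (*-identityˡ _)) (+-identityˡ _) ⟩
    y ^ p + x ^ p                                                    ≈⟨ +-comm _ _ ⟩
    x ^ p + y ^ p                                                    ∎
    where
    p : ℕ
    p = suc p′
    t : Fin (suc p) → Carrier
    t = binomialTerm x y p
    top≡p : toℕ (suc (fromℕ p′)) ≡ p
    top≡p = ≡.cong suc (toℕ-fromℕ p′)
    middle≈0 : sum (λ k → t (suc (inject₁ k))) ≈ 0#
    middle≈0 = trans (sum-cong-≋ λ k → m∣n⇒n·x≈0 p·1≈0 _ (p∣pCk p-prime (s≤s z≤n) (s≤s (inject₁<p′ k))))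
                     (sum-replicate-zero p′)
      where
      inject₁<p′ : ∀ k → toℕ (inject₁ k) ℕ.< p′
      inject₁<p′ k = ≡.subst (ℕ._< p′) (≡.sym (toℕ-inject₁ k)) (toℕ<n k)
    last≈xᵖ : ∀ k → toℕ k ≡ p → t k ≈ x ^ p
    last≈xᵖ k toℕk≡p with toℕ k
    last≈xᵖ k ≡.refl | .p = begin
      (p C p) · (x ^ p * y ^ (p ∸ p))  ≈⟨ ×-congˡ (nCn≡1 p) ⟩
      1 · (x ^ p * y ^ (p ∸ p))        ≈⟨ +-identityʳ _ ⟩
      x ^ p * y ^ (p ∸ p)              ≈⟨ *-congˡ (^-congʳ y (ℕ.n∸n≡0 p)) ⟩
      x ^ p * 1#                       ≈⟨ *-identityʳ _ ⟩
      x ^ p                            ∎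

  frobenius : ∀ {p} → Prime p → p · 1# ≈ 0# → ∀ n x y → (x + y) ^ (p ℕ.^ n) ≈ x ^ (p ℕ.^ n) + y ^ (p ℕ.^ n)
  frobenius p-prime p·1≈0 zero    x y = trans (*-identityʳ _) (sym (+-cong (*-identityʳ x) (*-identityʳ y)))
  frobenius {p} p-prime p·1≈0 (suc n) x y = begin
    (x + y) ^ (p ℕ.* pⁿ)            ≈⟨ ^-assocʳ (x + y) p pⁿ ⟨
    ((x + y) ^ p) ^ pⁿ              ≈⟨ ^-congˡ pⁿ (frobenius-prime p-prime p·1≈0 x y) ⟩
    (x ^ p + y ^ p) ^ pⁿ            ≈⟨ frobenius p-prime p·1≈0 n (x ^ p) (y ^ p) ⟩
    (x ^ p) ^ pⁿ + (y ^ p) ^ pⁿ     ≈⟨ +-cong (^-assocʳ x p pⁿ) (^-assocʳ y p pⁿ) ⟩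
    x ^ (p ℕ.* pⁿ) + y ^ (p ℕ.* pⁿ) ∎
    where
    pⁿ : ℕ
    pⁿ = p ℕ.^ n

-- Fields, the fixed field of x ↦ x ^ q, and its affine lines

module FieldProperties (F : CommutativeRing 0ℓ 0ℓ) (isField : IsField F) where

  open CommutativeRing F hiding (zero)
  open import Algebra.Properties.Semiring.Exp semiring using (_^_)
  open import Relation.Binary.Reasoning.Setoid setoid

  1#≉0# : ¬ 1# ≈ 0#
  1#≉0# = proj₁ isField

  1#^n≈1# : ∀ n → 1# ^ n ≈ 1#
  1#^n≈1# zero    = refl
  1#^n≈1# (suc n) = trans (*-identityˡ (1# ^ n)) (1#^n≈1# n)

  x*y≈0⇒y≈0 : ∀ {x y} → ¬ x ≈ 0# → x * y ≈ 0# → y ≈ 0#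
  x*y≈0⇒y≈0 {x} {y} x≉0 xy≈0 with x⁻¹ , xx⁻¹≈1 ← proj₂ isField x x≉0 = begin
    y              ≈⟨ *-identityˡ y ⟨
    1# * y         ≈⟨ *-congʳ xx⁻¹≈1 ⟨
    (x * x⁻¹) * y  ≈⟨ *-congʳ (*-comm x x⁻¹) ⟩
    (x⁻¹ * x) * y  ≈⟨ *-assoc x⁻¹ x y ⟩
    x⁻¹ * (x * y)  ≈⟨ *-congˡ xy≈0 ⟩
    x⁻¹ * 0#       ≈⟨ zeroʳ x⁻¹ ⟩
    0#             ∎

  x≉0∧y≉0⇒xy≉0 : ∀ {x y} → ¬ x ≈ 0# → ¬ y ≈ 0# → ¬ x * y ≈ 0#
  x≉0∧y≉0⇒xy≉0 x≉0 y≉0 xy≈0 = y≉0 (x*y≈0⇒y≈0 x≉0 xy≈0)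

  x^n≉0 : ∀ {x} n → ¬ x ≈ 0# → ¬ x ^ n ≈ 0#
  x^n≉0 zero    x≉0 = 1#≉0#
  x^n≉0 (suc n) x≉0 = x≉0∧y≉0⇒xy≉0 x≉0 (x^n≉0 n x≉0)

  *-cancelˡ-nonZero : ∀ {x y z} → ¬ x ≈ 0# → x * y ≈ x * z → y ≈ z
  *-cancelˡ-nonZero {x} {y} {z} x≉0 xy≈xz = x∙y⁻¹≈ε⇒x≈y y z (x*y≈0⇒y≈0 x≉0 (begin
    x * (y - z)    ≈⟨ x[y-z]≈xy-xz x y z ⟩
    x * y - x * z  ≈⟨ x≈y⇒x∙y⁻¹≈ε xy≈xz ⟩
    0#             ∎))
    where
    open import Algebra.Properties.Ring ring using (x[y-z]≈xy-xz)
    open import Algebra.Properties.AbelianGroup +-abelianGroup using (x∙y⁻¹≈ε⇒x≈y; x≈y⇒x∙y⁻¹≈ε)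

  module _ (_≈?_ : Decidable _≈_) where

    x^n≈0⇒x≈0 : ∀ {x} n → x ^ n ≈ 0# → x ≈ 0#
    x^n≈0⇒x≈0 {x} n xⁿ≈0 with x ≈? 0#
    ... | yes x≈0 = x≈0
    ... | no  x≉0 = contradiction xⁿ≈0 (x^n≉0 n x≉0)

module _ (F : CommutativeRing 0ℓ 0ℓ) where

  open CommutativeRing F hiding (zero)
  open import Algebra.Properties.Semiring.Exp semiring using (_^_)

  PowerIsAdditive : ℕ → Set
  PowerIsAdditive q = ∀ x y → (x + y) ^ q ≈ x ^ q + y ^ q

module FixedField (F : CommutativeRing 0ℓ 0ℓ) (isField : IsField F) {q : ℕ} (frobenius : PowerIsAdditive F q) where

  open CommutativeRing F hiding (zero)
  open import Algebra.Properties.Semiring.Exp semiring using (_^_; ^-congˡ)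
  open import Algebra.Properties.CommutativeSemiring.Exp commutativeSemiring using (^-distrib-*)
  open import Algebra.Properties.Ring ring using (x+x≈x⇒x≈0)
  open import Algebra.Properties.AbelianGroup +-abelianGroup using (inverseʳ-unique)
  open import Relation.Binary.Reasoning.Setoid setoid
  open FieldProperties F isField

  InFq-resp-≈ : ∀ {x y} → x ≈ y → InFq F q x → InFq F q y
  InFq-resp-≈ x≈y xᵠ≈x = trans (^-congˡ q (sym x≈y)) (trans xᵠ≈x x≈y)

  InFq-0# : InFq F q 0#
  InFq-0# = x+x≈x⇒x≈0 (0# ^ q) (begin
    0# ^ q + 0# ^ q  ≈⟨ frobenius 0# 0# ⟨
    (0# + 0#) ^ q    ≈⟨ ^-congˡ q (+-identityˡ 0#) ⟩
    0# ^ q           ∎)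

  InFq-1# : InFq F q 1#
  InFq-1# = 1#^n≈1# q

  InFq-+ : ∀ {x y} → InFq F q x → InFq F q y → InFq F q (x + y)
  InFq-+ x∈ y∈ = trans (frobenius _ _) (+-cong x∈ y∈)

  InFq-* : ∀ {x y} → InFq F q x → InFq F q y → InFq F q (x * y)
  InFq-* x∈ y∈ = trans (^-distrib-* _ _ q) (*-cong x∈ y∈)

  InFq-neg : ∀ {x} → InFq F q x → InFq F q (- x)
  InFq-neg {x} x∈ = trans (inverseʳ-unique (x ^ q) ((- x) ^ q) (begin
    x ^ q + (- x) ^ q  ≈⟨ frobenius x (- x) ⟨
    (x - x) ^ q        ≈⟨ ^-congˡ q (-‿inverseʳ x) ⟩
    0# ^ q             ≈⟨ InFq-0# ⟩
    0#                 ∎)) (-‿cong x∈)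

  InFq-- : ∀ {x y} → InFq F q x → InFq F q y → InFq F q (x - y)
  InFq-- x∈ y∈ = InFq-+ x∈ (InFq-neg y∈)

  InFq-*-cancelˡ : ∀ {x y} → ¬ x ≈ 0# → InFq F q x → InFq F q (x * y) → InFq F q y
  InFq-*-cancelˡ {x} {y} x≉0 x∈ xy∈ with x⁻¹ , xx⁻¹≈1 ← proj₂ isField x x≉0 =
    InFq-resp-≈ x⁻¹[xy]≈y (InFq-* x⁻¹∈ xy∈)
    where
    x⁻¹∈ : InFq F q x⁻¹
    x⁻¹∈ = *-cancelˡ-nonZero x≉0 (begin
      x * x⁻¹ ^ q      ≈⟨ *-congʳ x∈ ⟨
      x ^ q * x⁻¹ ^ q  ≈⟨ ^-distrib-* x x⁻¹ q ⟨
      (x * x⁻¹) ^ q    ≈⟨ ^-congˡ q xx⁻¹≈1 ⟩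
      1# ^ q           ≈⟨ InFq-1# ⟩
      1#               ≈⟨ xx⁻¹≈1 ⟨
      x * x⁻¹          ∎)
    x⁻¹[xy]≈y : x⁻¹ * (x * y) ≈ y
    x⁻¹[xy]≈y = begin
      x⁻¹ * (x * y)  ≈⟨ *-assoc x⁻¹ x y ⟨
      (x⁻¹ * x) * y  ≈⟨ *-congʳ (trans (*-comm x⁻¹ x) xx⁻¹≈1) ⟩
      1# * y         ≈⟨ *-identityˡ y ⟩
      y              ∎

Fin-injective⇒surjective : ∀ {n} (f : Fin n → Fin n) → (∀ {x y} → f x ≡ f y → x ≡ y) → ∀ y → ∃[ x ] f x ≡ y
Fin-injective⇒surjective {suc n} f f-injective y with any? (λ x → f x Fin.≟ y)
... | yes hit = hit
... | no  miss = contradiction (injective⇒≤ {f = f′} f′-injective) ℕ.1+n≰n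
  where
  f≢y : ∀ x → y ≡ f x → ⊥
  f≢y x y≡fx = miss (x , ≡.sym y≡fx)
  f′ : Fin (suc n) → Fin n
  f′ x = Fin.punchOut (f≢y x)
  f′-injective : ∀ {x x′} → f′ x ≡ f′ x′ → x ≡ x′
  f′-injective {x} {x′} eq = f-injective (punchOut-injective (f≢y x) (f≢y x′) eq)

module Spanning (F : CommutativeRing 0ℓ 0ℓ) (isField : IsField F) (_≈?_ : Decidable (CommutativeRing._≈_ F))
                {q : ℕ} (frobenius : PowerIsAdditive F q)
                {r : ℕ} (card : HasCard F (r ℕ.* r))
                (fq : Fin r → CommutativeRing.Carrier F) (fq-injective : ∀ {k l} → CommutativeRing._≈_ F (fq k) (fq l) → k ≡ l)
                (fq∈Fq : ∀ k → InFq F q (fq k)) where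

  open CommutativeRing F hiding (zero)
  open FixedField F isField {q} frobenius
  open import Relation.Binary.Reasoning.Setoid setoid

  Fq-coordinates-unique : ∀ {β x y x′ y′} → ¬ InFq F q β → InFq F q x → InFq F q y → InFq F q x′ → InFq F q y′ →
                          β * x + y ≈ β * x′ + y′ → x ≈ x′ × y ≈ y′
  Fq-coordinates-unique {β} {x} {y} {x′} {y′} β∉Fq x∈ y∈ x′∈ y′∈ eq with x ≈? x′
  ... | yes x≈x′ = x≈x′ , +-cancelˡ (β * x) y y′ (trans eq (+-congʳ (*-congˡ (sym x≈x′))))
    where open import Algebra.Properties.AbelianGroup +-abelianGroup using () renaming (∙-cancelˡ to +-cancelˡ)
  ... | no  x≉x′ = contradiction (InFq-*-cancelˡ x-x′≉0 (InFq-- x∈ x′∈) (InFq-resp-≈ [x-x′]β≈y′-y (InFq-- y′∈ y∈))) β∉Fq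
    where
    open import Algebra.Properties.AbelianGroup +-abelianGroup using (x∙y⁻¹≈ε⇒x≈y)
    open import Algebra.Properties.Ring ring using ([y-z]x≈yx-zx)
    x-x′≉0 : ¬ x - x′ ≈ 0#
    x-x′≉0 = x≉x′ ∘ x∙y⁻¹≈ε⇒x≈y x x′
    [x-x′]β≈y′-y : y′ - y ≈ (x - x′) * β
    [x-x′]β≈y′-y = sym (begin
      (x - x′) * β      ≈⟨ [y-z]x≈yx-zx β x x′ ⟩
      x * β - x′ * β    ≈⟨ +-cong (*-comm x β) (-‿cong (*-comm x′ β)) ⟩
      β * x - β * x′    ≈⟨ x∙y≈z∙w⇒x-z≈w-y +-abelianGroup eq ⟩
      y′ - y            ∎)

  module _ {β : Carrier} (β∉Fq : ¬ InFq F q β) where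

    open Inverse (Bijection⇒Inverse card) using (to; from; strictlyInverseˡ)
    open Inverse (*↔× {r} {r}) using () renaming (to to remQuot; from to combine; strictlyInverseʳ to combine∘remQuot)

    private
      point : Fin r × Fin r → Carrier
      point (k , l) = β * fq k + fq l

      point-injective : ∀ {kl kl′} → point kl ≈ point kl′ → kl ≡ kl′
      point-injective {k , l} {k′ , l′} eq
        with fqk≈fqk′ , fql≈fql′ ← Fq-coordinates-unique β∉Fq (fq∈Fq k) (fq∈Fq l) (fq∈Fq k′) (fq∈Fq l′) eq
        = ≡.cong₂ _,_ (fq-injective fqk≈fqk′) (fq-injective fql≈fql′)

      point-index : Fin (r ℕ.* r) → Fin (r ℕ.* r)
      point-index s = from (point (remQuot s))

      point-index-injective : ∀ {s s′} → point-index s ≡ point-index s′ → s ≡ s′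
      point-index-injective {s} {s′} eq = ≡.trans (≡.sym (combine∘remQuot s))
        (≡.trans (≡.cong combine (point-injective (from-injective eq))) (combine∘remQuot s′))
        where
        from-injective : ∀ {z z′} → from z ≡ from z′ → z ≈ z′
        from-injective {z} {z′} eq = trans (sym (strictlyInverseˡ z)) (trans (reflexive (≡.cong to eq)) (strictlyInverseˡ z′))

    -- (x, y) ↦ βx + y is injective on F_q × F_q, hence onto F, which has r · r elements.
    βFq+Fq-covers : ∀ z → ∃[ x ] ∃[ y ] InFq F q x × InFq F q y × β * x + y ≈ z
    βFq+Fq-covers z with s , index≡z ← Fin-injective⇒surjective point-index point-index-injective (from z) =
      fq (proj₁ (remQuot s)) , fq (proj₂ (remQuot s)) , fq∈Fq _ , fq∈Fq _ , (begin
        point (remQuot s)    ≈⟨ strictlyInverseˡ (point (remQuot s)) ⟨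
        to (point-index s)   ≡⟨ ≡.cong to index≡z ⟩
        to (from z)          ≈⟨ strictlyInverseˡ z ⟩
        z                    ∎)

module AffineLine (F : CommutativeRing 0ℓ 0ℓ) (isField : IsField F) (_≈?_ : Decidable (CommutativeRing._≈_ F))
                  {q : ℕ} (frobenius : PowerIsAdditive F q)
                  {a : CommutativeRing.Carrier F} (a∉Fq : ¬ InFq F q a) where

  open CommutativeRing F hiding (zero)
  open FixedField F isField {q} frobenius
  open import Algebra.Properties.AbelianGroup +-abelianGroup using (x∙y⁻¹≈ε⇒x≈y; //-rightDividesˡ; ⁻¹-anti-homo‿-; xyx⁻¹≈y)
  open import Algebra.Properties.Ring ring using ([y-z]x≈yx-zx)
  open import Relation.Binary.Reasoning.Setoid setoid

  OnLine-resp-≈ : ∀ {x y} → x ≈ y → OnLine F q a x → OnLine F q a y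
  OnLine-resp-≈ x≈y = InFq-resp-≈ (+-congʳ x≈y)

  OnLine⇒∉Fq : ∀ {x} → OnLine F q a x → ¬ InFq F q x
  OnLine⇒∉Fq {x} x-a∈ x∈ = a∉Fq (InFq-resp-≈ x-[x-a]≈a (InFq-- x∈ x-a∈))
    where
    x-[x-a]≈a : x - (x - a) ≈ a
    x-[x-a]≈a = begin
      x - (x - a)    ≈⟨ +-congˡ (⁻¹-anti-homo‿- x a) ⟩
      x + (a - x)    ≈⟨ +-assoc x a (- x) ⟨
      x + a - x      ≈⟨ xyx⁻¹≈y x a ⟩
      a              ∎

  OnLine-scaled⇒≈ : ∀ {x y k} → OnLine F q a x → OnLine F q a y → InFq F q k → y ≈ x * k → x ≈ y
  OnLine-scaled⇒≈ {x} {y} {k} x-a∈ y-a∈ k∈ y≈xk with (k - 1#) ≈? 0#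
  ... | yes k-1≈0 = begin
    x       ≈⟨ *-identityʳ x ⟨
    x * 1#  ≈⟨ *-congˡ (x∙y⁻¹≈ε⇒x≈y k 1# k-1≈0) ⟨
    x * k   ≈⟨ y≈xk ⟨
    y       ∎
  ... | no k-1≉0 = contradiction (InFq-*-cancelˡ k-1≉0 (InFq-- k∈ InFq-1#) (InFq-resp-≈ [k-1]a≈ (InFq-- y-a∈ (InFq-* x-a∈ k∈)))) a∉Fq
    where
    y-a+a≈[x-a]k+ak : (y - a) + a ≈ (x - a) * k + a * k
    y-a+a≈[x-a]k+ak = begin
      (y - a) + a             ≈⟨ //-rightDividesˡ a y ⟩
      y                       ≈⟨ y≈xk ⟩
      x * k                   ≈⟨ *-congʳ (//-rightDividesˡ a x) ⟨
      ((x - a) + a) * k       ≈⟨ distribʳ k (x - a) a ⟩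
      (x - a) * k + a * k     ∎
    [k-1]a≈ : (y - a) - (x - a) * k ≈ (k - 1#) * a
    [k-1]a≈ = begin
      (y - a) - (x - a) * k   ≈⟨ x∙y≈z∙w⇒x-z≈w-y +-abelianGroup y-a+a≈[x-a]k+ak ⟩
      a * k - a               ≈⟨ +-cong (*-comm a k) (-‿cong (sym (*-identityˡ a))) ⟩
      k * a - 1# * a          ≈⟨ [y-z]x≈yx-zx a k 1# ⟨
      (k - 1#) * a            ∎

  βx+y≈a⇒OnLine-βx : ∀ {β x y} → InFq F q x → InFq F q y → β * x + y ≈ a →
                      ¬ x ≈ 0# × OnLine F q a (β * x)
  βx+y≈a⇒OnLine-βx {β} {x} {y} x∈ y∈ βx+y≈a = x≉0 , InFq-resp-≈ (sym βx-a≈-y) (InFq-neg y∈)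
    where
    x≉0 : ¬ x ≈ 0#
    x≉0 x≈0 = a∉Fq (InFq-resp-≈ y≈a y∈)
      where
      y≈a : y ≈ a
      y≈a = begin
        y            ≈⟨ +-identityˡ y ⟨
        0# + y       ≈⟨ +-congʳ (zeroʳ β) ⟨
        β * 0# + y   ≈⟨ +-congʳ (*-congˡ x≈0) ⟨
        β * x + y    ≈⟨ βx+y≈a ⟩
        a            ∎
    βx-a≈-y : β * x - a ≈ - y
    βx-a≈-y = trans (x∙y≈z∙w⇒x-z≈w-y +-abelianGroup (trans βx+y≈a (sym (+-identityʳ a)))) (+-identityˡ (- y))

-- Primitive elements

module PrimitiveElement (F : CommutativeRing 0ℓ 0ℓ) (isField : IsField F) (_≈?_ : Decidable (CommutativeRing._≈_ F))
                        {N : ℕ} .{{_ : ℕ.NonZero N}} (card : HasCard F (suc N))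
                        (α : CommutativeRing.Carrier F) (α-primitive : IsPrimitive F N α) where

  open CommutativeRing F hiding (zero)
  open import Algebra.Properties.Semiring.Exp semiring using (_^_; ^-congʳ; ^-congˡ; ^-homo-*; ^-assocʳ)
  open import Relation.Binary.Reasoning.Setoid setoid
  open FieldProperties F isField

  x^d≈1⇒x^i≈x^[i%d] : ∀ {x} d .{{_ : ℕ.NonZero d}} → x ^ d ≈ 1# → ∀ i → x ^ i ≈ x ^ (i % d)
  x^d≈1⇒x^i≈x^[i%d] {x} d xᵈ≈1 i = begin
    x ^ i                            ≈⟨ ^-congʳ x (m≡m%n+[m/n]*n i d) ⟩
    x ^ (i % d ℕ.+ (i / d) ℕ.* d)    ≈⟨ ^-homo-* x (i % d) _ ⟩
    x ^ (i % d) * x ^ ((i / d) ℕ.* d) ≈⟨ *-congˡ (^-congʳ x (ℕ.*-comm (i / d) d)) ⟩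
    x ^ (i % d) * x ^ (d ℕ.* (i / d)) ≈⟨ *-congˡ (^-assocʳ x d (i / d)) ⟨
    x ^ (i % d) * (x ^ d) ^ (i / d)   ≈⟨ *-congˡ (trans (^-congˡ (i / d) xᵈ≈1) (1#^n≈1# (i / d))) ⟩
    x ^ (i % d) * 1#                  ≈⟨ *-identityʳ _ ⟩
    x ^ (i % d)                       ∎

  α≉0 : ¬ α ≈ 0#
  α≉0 = proj₁ α-primitive

  log : ∀ x → ¬ x ≈ 0# → ∃[ i ] i ℕ.< N × x ≈ α ^ i
  log = proj₂ α-primitive

  -- Pigeonhole: an order d < N would make x ↦ (0 if x ≈ 0, else 1 + log x mod d) an injection
  -- of the N + 1 elements of F into Fin (1 + d).
  α^d≉1 : ∀ {d} → 0 ℕ.< d → d ℕ.< N → ¬ α ^ d ≈ 1#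
  α^d≉1 {d@(suc _)} _ d<N αᵈ≈1 =
    ℕ.<⇒≱ d<N (ℕ.≤-pred (injective⇒≤ {f = residue-of-element} residue-injective))
    where
    open Bijection card using (to; injective)
    residue : ∀ x → Dec (x ≈ 0#) → Fin (suc d)
    residue x (yes _)   = zero
    residue x (no  x≉0) = suc (fromℕ< (m%n<n (proj₁ (log x x≉0)) d))
    residue-faithful : ∀ x y x≈?0 y≈?0 → residue x x≈?0 ≡ residue y y≈?0 → x ≈ y
    residue-faithful x y (yes x≈0) (yes y≈0) _ = trans x≈0 (sym y≈0)
    residue-faithful x y (no x≉0)  (no y≉0)  eq
      with i , _ , x≈αⁱ ← log x x≉0 | j , _ , y≈αʲ ← log y y≉0 = begin
      x            ≈⟨ x≈αⁱ ⟩
      α ^ i        ≈⟨ x^d≈1⇒x^i≈x^[i%d] d αᵈ≈1 i ⟩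
      α ^ (i % d)  ≡⟨ ≡.cong (α ^_) (fromℕ<-injective _ _ (m%n<n i d) (m%n<n j d) (suc-injective eq)) ⟩
      α ^ (j % d)  ≈⟨ x^d≈1⇒x^i≈x^[i%d] d αᵈ≈1 j ⟨
      α ^ j        ≈⟨ y≈αʲ ⟨
      y            ∎
    residue-of-element : Fin (suc N) → Fin (suc d)
    residue-of-element k = residue (to k) (to k ≈? 0#)
    residue-injective : ∀ {k l} → residue-of-element k ≡ residue-of-element l → k ≡ l
    residue-injective {k} {l} eq = injective (residue-faithful (to k) (to l) _ _ eq)

  α^i≈α^j⇒α^[j∸i]≈1 : ∀ {i j} → i ℕ.≤ j → α ^ i ≈ α ^ j → α ^ (j ∸ i) ≈ 1#
  α^i≈α^j⇒α^[j∸i]≈1 {i} {j} i≤j αⁱ≈αʲ = *-cancelˡ-nonZero (x^n≉0 i α≉0) (begin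
    α ^ i * α ^ (j ∸ i)   ≈⟨ ^-homo-* α i (j ∸ i) ⟨
    α ^ (i ℕ.+ (j ∸ i))   ≡⟨ ≡.cong (α ^_) (ℕ.m+[n∸m]≡n i≤j) ⟩
    α ^ j                 ≈⟨ αⁱ≈αʲ ⟨
    α ^ i                 ≈⟨ *-identityʳ _ ⟨
    α ^ i * 1#            ∎)

  α^N≈1 : α ^ N ≈ 1#
  α^N≈1 with log (α ^ N) (x^n≉0 N α≉0)
  ... | zero  , _   , αᴺ≈1 = αᴺ≈1
  ... | suc i , i<N , αᴺ≈αⁱ = contradiction (α^i≈α^j⇒α^[j∸i]≈1 (ℕ.<⇒≤ i<N) (sym αᴺ≈αⁱ))
                                           (α^d≉1 (ℕ.m<n⇒0<n∸m i<N) (ℕ.∸-monoʳ-< {o = 0} (s≤s z≤n) (ℕ.<⇒≤ i<N)))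

  α^i≈α^[i%N] : ∀ i → α ^ i ≈ α ^ (i % N)
  α^i≈α^[i%N] = x^d≈1⇒x^i≈x^[i%d] N α^N≈1

  α^e≈1⇒N∣e : ∀ e → α ^ e ≈ 1# → N ∣ e
  α^e≈1⇒N∣e e αᵉ≈1 with e % N in e%N≡r
  ... | zero  = m%n≡0⇒n∣m e N e%N≡r
  ... | suc r = contradiction (trans (sym (≡.subst (λ k → α ^ e ≈ α ^ k) e%N≡r (α^i≈α^[i%N] e))) αᵉ≈1)
                              (α^d≉1 (s≤s z≤n) (≡.subst (ℕ._< N) e%N≡r (m%n<n e N)))

  N∣e⇒α^e≈1 : ∀ e → N ∣ e → α ^ e ≈ 1#
  N∣e⇒α^e≈1 e (divides c e≡c*N) = begin
    α ^ e             ≡⟨ ≡.cong (α ^_) (≡.trans e≡c*N (ℕ.*-comm c N)) ⟩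
    α ^ (N ℕ.* c)     ≈⟨ ^-assocʳ α N c ⟨
    (α ^ N) ^ c       ≈⟨ ^-congˡ c α^N≈1 ⟩
    1# ^ c            ≈⟨ 1#^n≈1# c ⟩
    1#                ∎

  α^-injective-≤ : ∀ {i j} → i ℕ.≤ j → j ℕ.< N → α ^ i ≈ α ^ j → i ≡ j
  α^-injective-≤ {i} {j} i≤j j<N αⁱ≈αʲ with j ∸ i in j∸i≡d | α^i≈α^j⇒α^[j∸i]≈1 i≤j αⁱ≈αʲ
  ... | zero  | _    = ℕ.≤-antisym i≤j (ℕ.m∸n≡0⇒m≤n j∸i≡d)
  ... | suc d | αᵈ≈1 = contradiction αᵈ≈1 (α^d≉1 (s≤s z≤n) (≡.subst (ℕ._< N) j∸i≡d (ℕ.≤-<-trans (ℕ.m∸n≤m j i) j<N)))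

  α^-injective : ∀ {i j} → i ℕ.< N → j ℕ.< N → α ^ i ≈ α ^ j → i ≡ j
  α^-injective {i} {j} i<N j<N αⁱ≈αʲ with ℕ.≤-total i j
  ... | inj₁ i≤j = α^-injective-≤ i≤j j<N αⁱ≈αʲ
  ... | inj₂ j≤i = ≡.sym (α^-injective-≤ j≤i i<N (sym αⁱ≈αʲ))

-- The line ℓ₀ and the powers of a primitive element

module LineThroughNonFqPoint
  (F : CommutativeRing 0ℓ 0ℓ) (isField : IsField F) (_≈?_ : Decidable (CommutativeRing._≈_ F))
  {q : ℕ} (q-primePower : IsPrimePower q) (card : HasCard F (q ℕ.* q))
  (α : CommutativeRing.Carrier F) (α-primitive : IsPrimitive F (q ℕ.* q ∸ 1) α)
  (a : CommutativeRing.Carrier F) (a∉Fq : ¬ InFq F q a)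
  where

  open CommutativeRing F hiding (zero)
  open import Algebra.Properties.Semiring.Exp semiring using (_^_; ^-congʳ; ^-congˡ; ^-homo-*; ^-assocʳ)
  open import Algebra.Properties.Semiring.Mult semiring using (×1-homo-*; ×-congˡ) renaming (_×_ to _·_)
  open import Relation.Binary.Reasoning.Setoid setoid
  open FieldProperties F isField
  open Frobenius commutativeSemiring using (frobenius)

  private
    p n : ℕ
    p = proj₁ q-primePower
    n = proj₁ (proj₂ q-primePower)
    p-prime : Prime p
    p-prime = proj₁ (proj₂ (proj₂ q-primePower))
    1≤n : 1 ℕ.≤ n
    1≤n = proj₁ (proj₂ (proj₂ (proj₂ q-primePower)))
    q≡pⁿ : q ≡ p ℕ.^ n
    q≡pⁿ = proj₂ (proj₂ (proj₂ (proj₂ q-primePower)))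

  p·1≈0 : p · 1# ≈ 0#
  p·1≈0 = x^n≈0⇒x≈0 _≈?_ (n ℕ.+ n) (begin
    (p · 1#) ^ (n ℕ.+ n)    ≈⟨ [p^k]·1≈[p·1]^k (n ℕ.+ n) ⟨
    (p ℕ.^ (n ℕ.+ n)) · 1#  ≡⟨ ≡.cong (_· 1#) (≡.trans (ℕ.^-distribˡ-+-* p n n) (≡.cong₂ ℕ._*_ (≡.sym q≡pⁿ) (≡.sym q≡pⁿ))) ⟩
    (q ℕ.* q) · 1#          ≈⟨ FiniteAbelianGroup.card·x≈ε +-abelianGroup card 1# ⟩
    0#                      ∎)
    where
    [p^k]·1≈[p·1]^k : ∀ k → (p ℕ.^ k) · 1# ≈ (p · 1#) ^ k
    [p^k]·1≈[p·1]^k zero    = +-identityʳ 1#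
    [p^k]·1≈[p·1]^k (suc k) = trans (×1-homo-* p (p ℕ.^ k)) (*-congˡ ([p^k]·1≈[p·1]^k k))

  frobenius-q : PowerIsAdditive F q
  frobenius-q x y = begin
    (x + y) ^ q                    ≡⟨ ≡.cong ((x + y) ^_) q≡pⁿ ⟩
    (x + y) ^ (p ℕ.^ n)            ≈⟨ frobenius p-prime p·1≈0 n x y ⟩
    x ^ (p ℕ.^ n) + y ^ (p ℕ.^ n)  ≡⟨ ≡.cong₂ (λ i j → x ^ i + y ^ j) (≡.sym q≡pⁿ) (≡.sym q≡pⁿ) ⟩
    x ^ q + y ^ q                  ∎

  open FixedField F isField {q} frobenius-q
  open AffineLine F isField _≈?_ {q} frobenius-q a∉Fq

  1<q : 1 ℕ.< q
  1<q = ℕ.<-≤-trans (nonTrivial⇒n>1 p {{prime⇒nonTrivial p-prime}}) p≤q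
    where
    p≤q : p ℕ.≤ q
    p≤q = ≡.subst (p ℕ.≤_) (≡.sym q≡pⁿ) (≡.subst (ℕ._≤ p ℕ.^ n) (ℕ.*-identityʳ p) (ℕ.^-monoʳ-≤ p {{prime⇒nonZero p-prime}} 1≤n))

  instance
    q-nonZero : NonZero q
    q-nonZero = ℕ.>-nonZero (ℕ.<-trans ℕ.0<1+n 1<q)
    q∸1-nonZero : NonZero (q ∸ 1)
    q∸1-nonZero = ℕ.>-nonZero (ℕ.m<n⇒0<n∸m 1<q)

  N : ℕ
  N = q ℕ.* q ∸ 1

  N≡[1+q]*[q∸1] : N ≡ suc q ℕ.* (q ∸ 1)
  N≡[1+q]*[q∸1] = q*q∸1≡[1+q]*[q∸1] q

  instance
    N-nonZero : NonZero N
    N-nonZero = ≡.subst NonZero (≡.sym N≡[1+q]*[q∸1]) (ℕ.m*n≢0 (suc q) (q ∸ 1))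

  hasCard-1+N : HasCard F (suc N)
  hasCard-1+N = ≡.subst (HasCard F) (≡.sym (ℕ.suc-pred (q ℕ.* q) {{ℕ.m*n≢0 q q}})) card

  open PrimitiveElement F isField _≈?_ hasCard-1+N α α-primitive

  [α^i]^q≈α^i*α^[i*[q∸1]] : ∀ i → (α ^ i) ^ q ≈ α ^ i * α ^ (i ℕ.* (q ∸ 1))
  [α^i]^q≈α^i*α^[i*[q∸1]] i = begin
    (α ^ i) ^ q                   ≈⟨ ^-assocʳ α i q ⟩
    α ^ (i ℕ.* q)                 ≡⟨ ≡.cong (λ k → α ^ (i ℕ.* k)) (ℕ.suc-pred q) ⟨
    α ^ (i ℕ.* suc (q ∸ 1))       ≡⟨ ≡.cong (α ^_) (ℕ.*-suc i (q ∸ 1)) ⟩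
    α ^ (i ℕ.+ i ℕ.* (q ∸ 1))     ≈⟨ ^-homo-* α i (i ℕ.* (q ∸ 1)) ⟩
    α ^ i * α ^ (i ℕ.* (q ∸ 1))   ∎

  α^i∈Fq⇒[1+q]∣i : ∀ i → InFq F q (α ^ i) → suc q ∣ i
  α^i∈Fq⇒[1+q]∣i i αⁱ∈Fq = *-cancelʳ-∣ (q ∸ 1) (≡.subst (_∣ i ℕ.* (q ∸ 1)) N≡[1+q]*[q∸1] (α^e≈1⇒N∣e _
    (*-cancelˡ-nonZero (x^n≉0 i α≉0) (begin
      α ^ i * α ^ (i ℕ.* (q ∸ 1))   ≈⟨ [α^i]^q≈α^i*α^[i*[q∸1]] i ⟨
      (α ^ i) ^ q                   ≈⟨ αⁱ∈Fq ⟩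
      α ^ i                         ≈⟨ *-identityʳ _ ⟨
      α ^ i * 1#                    ∎))))

  [1+q]∣i⇒α^i∈Fq : ∀ i → suc q ∣ i → InFq F q (α ^ i)
  [1+q]∣i⇒α^i∈Fq i [1+q]∣i = begin
    (α ^ i) ^ q                   ≈⟨ [α^i]^q≈α^i*α^[i*[q∸1]] i ⟩
    α ^ i * α ^ (i ℕ.* (q ∸ 1))   ≈⟨ *-congˡ (N∣e⇒α^e≈1 _ (≡.subst (_∣ i ℕ.* (q ∸ 1)) (≡.sym N≡[1+q]*[q∸1])
                                                             (*-pres-∣ [1+q]∣i (∣-refl {q ∸ 1})))) ⟩
    α ^ i * 1#                    ≈⟨ *-identityʳ _ ⟩
    α ^ i                         ∎

  -- Since α^(q+1) has order q - 1, the values at 0, …, q - 1 are the q elements of F_q.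
  Fq-element : ℕ → Carrier
  Fq-element zero    = 0#
  Fq-element (suc k) = α ^ (suc q ℕ.* k)

  Fq-element∈Fq : ∀ k → InFq F q (Fq-element k)
  Fq-element∈Fq zero    = InFq-0#
  Fq-element∈Fq (suc k) = [1+q]∣i⇒α^i∈Fq _ (m∣m*n k)

  Fq-element-injective : ∀ {k l} → k ℕ.< q → l ℕ.< q → Fq-element k ≈ Fq-element l → k ≡ l
  Fq-element-injective {zero}  {zero}  _   _   _  = ≡.refl
  Fq-element-injective {zero}  {suc l} _   _   eq = contradiction (sym eq) (x^n≉0 (suc q ℕ.* l) α≉0)
  Fq-element-injective {suc k} {zero}  _   _   eq = contradiction eq (x^n≉0 (suc q ℕ.* k) α≉0)
  Fq-element-injective {suc k} {suc l} k<q l<q eq =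
    ≡.cong suc (ℕ.*-cancelˡ-≡ k l (suc q) (α^-injective (exponent<N k<q) (exponent<N l<q) eq))
    where
    exponent<N : ∀ {j} → suc j ℕ.< q → suc q ℕ.* j ℕ.< N
    exponent<N {j} j<q = ≡.subst (suc q ℕ.* j ℕ.<_) (≡.sym N≡[1+q]*[q∸1]) (ℕ.*-monoʳ-< (suc q) (ℕ.∸-monoˡ-< j<q (s≤s z≤n)))

  open Spanning F isField _≈?_ {q} frobenius-q card (Fq-element ∘ toℕ)
                (λ eq → toℕ-injective (Fq-element-injective (toℕ<n _) (toℕ<n _) eq)) (Fq-element∈Fq ∘ toℕ)

  OnLine⇒[1+q]∤i : ∀ {i} → OnLine F q a (α ^ i) → ¬ suc q ∣ i
  OnLine⇒[1+q]∤i {i} on-line [1+q]∣i = OnLine⇒∉Fq on-line ([1+q]∣i⇒α^i∈Fq i [1+q]∣i)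

  OnLine-residue-≡⇒≈ : ∀ {i j} → i ℕ.≤ j → OnLine F q a (α ^ i) → OnLine F q a (α ^ j) →
                       i % suc q ≡ j % suc q → α ^ i ≈ α ^ j
  OnLine-residue-≡⇒≈ {i} {j} i≤j i-on j-on i≡j =
    OnLine-scaled⇒≈ i-on j-on ([1+q]∣i⇒α^i∈Fq (j ∸ i) (%≡%⇒∣∸ (suc q) {i} {j} i≡j)) (begin
      α ^ j                 ≡⟨ ≡.cong (α ^_) (ℕ.m+[n∸m]≡n i≤j) ⟨
      α ^ (i ℕ.+ (j ∸ i))   ≈⟨ ^-homo-* α i (j ∸ i) ⟩
      α ^ i * α ^ (j ∸ i)   ∎)

  OnLine-residue-injective : ∀ {i j} → i ℕ.< N → j ℕ.< N → OnLine F q a (α ^ i) → OnLine F q a (α ^ j) →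
                             i % suc q ≡ j % suc q → i ≡ j
  OnLine-residue-injective {i} {j} i<N j<N i-on j-on i≡j with ℕ.≤-total i j
  ... | inj₁ i≤j = α^-injective i<N j<N (OnLine-residue-≡⇒≈ i≤j i-on j-on i≡j)
  ... | inj₂ j≤i = α^-injective i<N j<N (sym (OnLine-residue-≡⇒≈ j≤i j-on i-on (≡.sym i≡j)))

  OnLine-residue-surjective : ∀ {j} → ¬ suc q ∣ j → ∃[ i ] i ℕ.< N × OnLine F q a (α ^ i) × i % suc q ≡ j % suc q
  OnLine-residue-surjective {j} [1+q]∤j
    with x , y , x∈Fq , y∈Fq , βx+y≈a ← βFq+Fq-covers (λ αʲ∈Fq → [1+q]∤j (α^i∈Fq⇒[1+q]∣i j αʲ∈Fq)) a
    with x≉0 , βx-on ← βx+y≈a⇒OnLine-βx x∈Fq y∈Fq βx+y≈a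
    with l , l<N , x≈αˡ ← log x x≉0 =
    (j ℕ.+ l) % N , m%n<n (j ℕ.+ l) N , OnLine-resp-≈ βx≈α^i βx-on , residue≡
    where
    [1+q]∣l : suc q ∣ l
    [1+q]∣l = α^i∈Fq⇒[1+q]∣i l (InFq-resp-≈ x≈αˡ x∈Fq)
    βx≈α^i : α ^ j * x ≈ α ^ ((j ℕ.+ l) % N)
    βx≈α^i = begin
      α ^ j * x              ≈⟨ *-congˡ x≈αˡ ⟩
      α ^ j * α ^ l          ≈⟨ ^-homo-* α j l ⟨
      α ^ (j ℕ.+ l)          ≈⟨ α^i≈α^[i%N] (j ℕ.+ l) ⟩
      α ^ ((j ℕ.+ l) % N)    ∎
    residue≡ : (j ℕ.+ l) % N % suc q ≡ j % suc q
    residue≡ = ≡.trans (m∣n⇒o%n%m≡o%m (suc q) N (j ℕ.+ l) (divides (q ∸ 1) (≡.trans N≡[1+q]*[q∸1] (ℕ.*-comm (suc q) (q ∸ 1)))))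
                       (%-remove-+ʳ j [1+q]∣l)

  OnLine? : ∀ i → Dec (OnLine F q a (α ^ i))
  OnLine? i = ((α ^ i - a) ^ q) ≈? (α ^ i - a)

  OnLine-residue-into : ∀ {i} → i ℕ.< N → OnLine F q a (α ^ i) → i % suc q ℕ.< suc q × 0 ℕ.< i % suc q
  OnLine-residue-into {i} _ on = m%n<n i (suc q) , ℕ.n≢0⇒n>0 (λ i%[1+q]≡0 → OnLine⇒[1+q]∤i on (m%n≡0⇒n∣m i (suc q) i%[1+q]≡0))

  OnLine-residue-onto : ∀ {j} → j ℕ.< suc q → 0 ℕ.< j → ∃[ i ] i ℕ.< N × OnLine F q a (α ^ i) × i % suc q ≡ j
  OnLine-residue-onto {j} j<1+q 0<j =
    let i , i<N , on , i≡j = OnLine-residue-surjective (λ [1+q]∣j → ℕ.<⇒≱ j<1+q (∣⇒≤ {{ℕ.>-nonZero 0<j}} [1+q]∣j))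
    in  i , i<N , on , ≡.trans i≡j (m<n⇒m%n≡m j<1+q)

  -- w unfolds to count ((λ i → i % t ≟ u) ∩? OnLine?) N.
  count-OnLine-residue : ∀ t .{{_ : NonZero t}} u → t ∣ suc q →
                         w F _≈?_ q t α a u ≡ count ((λ j → j % t ≟ u) ∩? (0 <?_)) (suc q)
  count-OnLine-residue t u t∣1+q = ≡.trans
    (count-cong ((λ i → i % t ≟ u) ∩? OnLine?) ((λ i → i % suc q % t ≟ u) ∩? OnLine?) N
                (λ _ (i%t≡u , on) → ≡.trans (i%[1+q]%t≡i%t _) i%t≡u , on)
                (λ _ (i%t≡u , on) → ≡.trans (≡.sym (i%[1+q]%t≡i%t _)) i%t≡u , on))
    (count-image OnLine? (0 <?_) (_% suc q) OnLine-residue-into OnLine-residue-injective OnLine-residue-onto (λ j → j % t ≟ u))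
    where
    i%[1+q]%t≡i%t : ∀ i → i % suc q % t ≡ i % t
    i%[1+q]%t≡i%t i = m∣n⇒o%n%m≡o%m t (suc q) i t∣1+q

open import Data.Nat using (_+_; _*_; _≤_; _<_)
open import Data.Nat.Properties using (+-comm)
open import Relation.Binary.PropositionalEquality using (subst; trans; sym; cong; module ≡-Reasoning)

proposition10 : (q t : ℕ) .{{_ : NonZero t}} → IsPrimePower q → 2 ≤ t → t ∣ (q + 1) →
    (F : CommutativeRing 0ℓ 0ℓ) → IsField F → HasCard F (q * q) →
    (_≈?_ : Decidable (CommutativeRing._≈_ F)) →
    (α : CommutativeRing.Carrier F) → IsPrimitive F (q * q ∸ 1) α →
    (a : CommutativeRing.Carrier F) → ¬ InFq F q a →
    ((u : ℕ) → 1 ≤ u → u < t → w F _≈?_ q t α a u ≡ (q + 1) / t)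
    × w F _≈?_ q t α a 0 ≡ (q + 1) / t ∸ 1
proposition10 q t q-primePower _ t∣q+1 F isField card _≈?_ α α-primitive a a∉Fq =
  (λ u 0<u u<t → begin
     w F _≈?_ q t α a u                             ≡⟨ count-OnLine-residue t u t∣1+q ⟩
     count (R? u ∩? (0 <?_)) (1 + q)                ≡⟨ cong (count (R? u ∩? (0 <?_))) 1+q≡s*t ⟩
     count (R? u ∩? (0 <?_)) (s * t)                ≡⟨ count-residue-positive t u s 0<u u<t ⟩
     s                                              ∎) ,
  (begin
     w F _≈?_ q t α a 0                             ≡⟨ count-OnLine-residue t 0 t∣1+q ⟩
     count (R? 0 ∩? (0 <?_)) (1 + q)                ≡⟨ cong (count (R? 0 ∩? (0 <?_))) 1+q≡s*t ⟩
     count (R? 0 ∩? (0 <?_)) (s * t)                ≡⟨ count-residue-zero t s ⟩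
     s ∸ 1                                          ∎)
  where
  open LineThroughNonFqPoint F isField _≈?_ q-primePower card α α-primitive a a∉Fq
  open ≡-Reasoning
  s : ℕ
  s = (q + 1) / t
  R? : (u j : ℕ) → Dec (j % t ≡ u)
  R? u j = j % t ≟ u
  1+q≡s*t : 1 + q ≡ s * t
  1+q≡s*t = trans (+-comm 1 q) (sym (m/n*n≡m t∣q+1))
  t∣1+q : t ∣ 1 + q
  t∣1+q = subst (t ∣_) (+-comm q 1) t∣q+1
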